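{- Let $\mathcal{T}$ be a single-elimination tournament with at least $2$ vertices and $u\in V(\mathcal{T})$. If there is no $x\in N^+(u)$ with $N^-(x)=\{a,u\}$ for some player $a\in P(\mathcal{T})$, then there exists a partition $\mathcal{A}$ of $P(\mathcal{T})\setminus P(u)$ such that: (i) for every $A\in\mathcal{A}$ and every $a\in A$ there exists $b\in A\setminus\{a\}$ such that $b\in P(x)$ for every match $x$ with $a\in P(x)$; and (ii) $\displaystyle |\mathcal{A}|=\sum_{x\in M(\mathcal{T})\setminus V(\mathcal{T}_u)}\Big\lfloor\frac{|N^-(x)\cap(P(\mathcal{T})\setminus P(u))|}{2}\Big\rfloor.$
   Context: For a digraph, $N^+(v)$ is the set of out-neighbours of $v$ and $N^-(v)$ the set of in-neighbours; a sink has $N^+(v)=\emptyset$, a source has $N^-(v)=\emptyset$. A single-elimination tournament $\mathcal{T}$ is a finite digraph with: exactly one sink; $|N^+(v)|=1$ for every non-sink $v$; no directed cycles; and $|N^-(v)|\ne 1$ for every vertex $v$. Players $P(\mathcal{T})$ are the sources; matches $M(\mathcal{T})$ are the non-sources. A directed walk from $u_1$ to $u_t$ is a sequence $(u_1,\dots,u_t)$, $t\ge1$, with $u_{i+1}\in N^+(u_i)$; the player set $P(v)$ of a vertex $v$ is the set of players $a$ with a directed walk from $a$ to $v$. For $u\in V(\mathcal{T})$, $\mathcal{T}_u$ is the digraph obtained from $\mathcal{T}$ by deleting every vertex $v$ with $P(v)\not\subseteq P(u)$. -}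

module Defs where

open import Data.Nat using (ℕ; zero; suc; _+_; _/_)
open import Data.Fin using (Fin)
open import Data.Fin.Subset using (Subset; _∈_; Nonempty)
open import Data.Bool using (Bool; true)
open import Data.List using (List; []; _∷_; length)
open import Data.List.Relation.Unary.Unique.Propositional using (Unique)
import Data.List.Membership.Propositional as LM
open import Data.Product using (Σ; ∃; _×_; _,_)
open import Data.Sum using (_⊎_)
open import Relation.Nullary using (¬_)
open import Relation.Binary.PropositionalEquality using (_≡_)
open import Function.Bundles using (_⇔_)

-- A finite digraph on vertex set Fin n, given by its adjacency relation:
-- E u v ≡ true  means there is an arc u → v  (v ∈ N⁺(u), u ∈ N⁻(v)).
Digraph : ℕ → Set
Digraph n = Fin n → Fin n → Bool

module _ {n : ℕ} (E : Digraph n) where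

  Arc : Fin n → Fin n → Set
  Arc u v = E u v ≡ true

  Card : (Fin n → Set) → ℕ → Set
  Card S k = Σ (List (Fin n)) λ xs →
    Unique xs × length xs ≡ k × (∀ x → (x LM.∈ xs) ⇔ S x)

  Sink : Fin n → Set
  Sink v = ∀ w → ¬ Arc v w

  Source : Fin n → Set
  Source v = ∀ w → ¬ Arc w v

  data Walk : Fin n → Fin n → Set where
    here : ∀ {u} → Walk u u
    step : ∀ {u w v} → Arc u w → Walk w v → Walk u v

  Acyclic : Set
  Acyclic = ∀ u w → Arc u w → ¬ Walk w u

  record IsSET : Set where
    field
      oneSink     : Σ (Fin n) λ s → Sink s × (∀ v → Sink v → v ≡ s)
      outDegOne   : ∀ v → ¬ Sink v → Card (λ w → Arc v w) 1
      acyclic     : Acyclic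
      inDegNotOne : ∀ v → ¬ Card (λ w → Arc w v) 1

  Player : Fin n → Set
  Player = Source

  Match : Fin n → Set
  Match v = ¬ Source v

  InP : Fin n → Fin n → Set
  InP v a = Player a × Walk a v

  -- v ∈ V(𝒯_u)  iff  P(v) ⊆ P(u)
  InVSub : Fin n → Fin n → Set
  InVSub u v = ∀ a → InP v a → InP u a

  OutsideP : Fin n → Fin n → Set
  OutsideP u a = Player a × ¬ InP u a

  record IsPartition (S : Fin n → Set) (k : ℕ) (B : Fin k → Subset n) : Set where
    field
      nonempty : ∀ i → Nonempty (B i)
      disjoint : ∀ i j a → a ∈ B i → a ∈ B j → i ≡ j
      covers   : ∀ a → S a ⇔ (∃ λ i → a ∈ B i)

  data SumRel (S : Fin n → Set) (f : Fin n → ℕ → Set) : List (Fin n) → ℕ → Set where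
    []   : SumRel S f [] 0
    skip : ∀ {x xs m} → ¬ S x → SumRel S f xs m → SumRel S f (x ∷ xs) m
    take : ∀ {x xs m c} → S x → f x c → SumRel S f xs m → SumRel S f (x ∷ xs) (c / 2 + m)

{-# OPTIONS --safe #-}
module Submission where

open import Defs
open import Data.Nat as ℕ using (ℕ; suc; _+_; _∸_; _≤_; _<_; _/_; _%_; NonZero; >-nonZero; z≤n; s≤s; s≤s⁻¹; _<?_; _≤?_)
open import Data.Nat.Properties using (≮⇒≥; ≰⇒>; <⇒≢; n≮0; m<m+n; m≤m+n; +-monoˡ-<; ≤-trans; <-≤-trans; ≤-<-trans; m∸n≤m; ∸-monoʳ-<; *-comm; +-identityʳ)
open import Data.Nat.DivMod using (m/n*n≤m; m≥n⇒m/n>0; m/n≢0⇒n≤m; m%n<n; [m+n]%n≡m%n; m≤n⇒[n∸m]%m≡n%m; m<n⇒m%n≡m)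
open import Data.Nat.ListAction using (sum)
open import Data.Fin as Fin using (Fin; toℕ; fromℕ<; splitAt; join; _↑ˡ_; _↑ʳ_)
open import Data.Fin.Properties using (toℕ-fromℕ<; toℕ<n; toℕ-injective; splitAt-↑ˡ; splitAt-↑ʳ; join-splitAt; any?; all?)
open import Data.Fin.Induction using (spo-wellFounded; spo-noetherian)
open import Data.Fin.Subset using (Subset; _∈_)
open import Data.List using (List; []; _∷_; length; lookup; filter; allFin; map)
open import Data.List.Relation.Unary.Any using (here; there)
open import Data.List.Relation.Unary.Any.Properties using (singleton⁻)
open import Data.List.Relation.Unary.All as All using ()
open import Data.List.Relation.Unary.AllPairs using ([]; _∷_)
open import Data.List.Relation.Unary.Unique.Propositional using (Unique)
open import Data.List.Relation.Unary.Unique.Propositional.Properties using (filter⁺; allFin⁺)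
import Data.List.Membership.Propositional as List
open import Data.List.Membership.Propositional.Properties using (∈-lookup; ∈-filter⁺; ∈-filter⁻; ∈-allFin)
open import Data.Vec using (tabulate)
open import Data.Vec.Properties using (lookup∘tabulate; []=⇒lookup; lookup⇒[]=)
open import Data.Bool using (true)
import Data.Bool.Properties as Bool
open import Data.Product using (Σ; ∃; _×_; _,_; proj₁; proj₂)
open import Data.Product.Properties using (≡-dec)
open import Data.Sum using (_⊎_; inj₁; inj₂; [_,_])
open import Data.Empty using (⊥; ⊥-elim)
open import Function using (_∘_; flip)
open import Function.Bundles using (_⇔_; mk⇔; Equivalence)
open import Induction.WellFounded using (WellFounded; Acc; acc; module Subrelation)
open import Relation.Nullary using (¬_; Dec; yes; no; does; proof)
open import Relation.Nullary.Reflects using (Reflects; invert)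
open import Relation.Nullary.Decidable using (_×-dec_; ¬?; decidable-stable; map′; dec-true)
open import Relation.Unary using () renaming (Decidable to Decidable₁)
open import Relation.Binary using (Rel; Decidable; DecidableEquality; IsStrictPartialOrder)
open import Relation.Binary.PropositionalEquality using (_≡_; _≢_; refl; sym; trans; cong; subst; isEquivalence)

-- Call a match x exterior if x ∉ V(𝒯_u), and let c_x count its in-neighbours in P(𝒯) ∖ P(u).
-- The blocks are indexed by the pairs (x , j) with x exterior and j < ⌊c_x/2⌋, which gives (ii).
-- If c_x ≥ 2, the outside players entering x are dealt into ⌊c_x/2⌋ classes by their position
-- modulo ⌊c_x/2⌋, so that every class has at least two members. An outside player a whose parent w
-- has c_w = 1 is handled by descent: since no match has in-neighbourhood {a , u} and no vertex has
-- in-degree 1, some in-neighbour of w is again an exterior match, and repeating this one reaches an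
-- exterior match z below w with c_z ≥ 2; a then joins class 0 of z. Either way a's block contains
-- another player below the parent of a, hence in every match that a reaches, which gives (i).

half+half≤ : ∀ c → c / 2 + c / 2 ≤ c
half+half≤ c = subst (_≤ c) (trans (*-comm (c / 2) 2) (cong (c / 2 +_) (+-identityʳ (c / 2)))) (m/n*n≤m c 2)

%-partner : ∀ {h c p} .{{_ : NonZero h}} → h + h ≤ c → p < c →
            ∃ λ q → q < c × q ≢ p × q % h ≡ p % h
%-partner {h} {c} {p} h+h≤c p<c with p <? h
... | yes p<h = p + h , <-≤-trans (+-monoˡ-< h p<h) h+h≤c
              , (λ eq → <⇒≢ (m<m+n p (≤-<-trans z≤n p<h)) (sym eq))
              , [m+n]%n≡m%n p h
... | no p≮h = p ∸ h , ≤-<-trans (m∸n≤m p h) p<c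
             , <⇒≢ (∸-monoʳ-< {o = 0} (≤-<-trans z≤n (m%n<n p h)) (≮⇒≥ p≮h))
             , m≤n⇒[n∸m]%m≡n%m (≮⇒≥ p≮h)

∈-length≤1 : ∀ {A : Set} {xs : List A} {x y} → length xs ≤ 1 → x List.∈ xs → y List.∈ xs → x ≡ y
∈-length≤1 {xs = _ ∷ []} _ (here x≡z) (here y≡z) = trans x≡z (sym y≡z)
∈-length≤1 {xs = _ ∷ _ ∷ _} (s≤s ())

module _ {A : Set} (_≟_ : DecidableEquality A) where

  position : A → List A → ℕ
  position x [] = 0
  position x (y ∷ ys) with x ≟ y
  ... | yes _ = 0
  ... | no _ = suc (position x ys)

  position-< : ∀ {x xs} → x List.∈ xs → position x xs < length xs
  position-< {x} {y ∷ ys} x∈ with x ≟ y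
  position-< _ | yes _ = s≤s z≤n
  position-< (here x≡y) | no x≢y = ⊥-elim (x≢y x≡y)
  position-< (there x∈) | no _ = s≤s (position-< x∈)

  position-lookup : ∀ {xs} → Unique xs → ∀ i → position (lookup xs i) xs ≡ toℕ i
  position-lookup {y ∷ ys} _ Fin.zero with y ≟ y
  ... | yes _ = refl
  ... | no y≢y = ⊥-elim (y≢y refl)
  position-lookup {y ∷ ys} (y∉ys ∷ ys!) (Fin.suc i) with lookup ys i ≟ y
  ... | yes eq = ⊥-elim (All.lookup y∉ys (∈-lookup i) (sym eq))
  ... | no _ = cong suc (position-lookup ys! i)

  module PairUp {xs : List A} (xs! : Unique xs) (2≤len : 2 ≤ length xs) where

    private
      instance
        half-nonZero : NonZero (length xs / 2)
        half-nonZero = >-nonZero (m≥n⇒m/n>0 2≤len)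

    pairClass : A → ℕ
    pairClass x = position x xs % (length xs / 2)

    pairClass-< : ∀ x → pairClass x < length xs / 2
    pairClass-< x = m%n<n (position x xs) (length xs / 2)

    private
      at : ∀ {q} → q < length xs → A
      at q<len = lookup xs (fromℕ< q<len)

      position-at : ∀ {q} (q<len : q < length xs) → position (at q<len) xs ≡ q
      position-at q<len = trans (position-lookup xs! (fromℕ< q<len)) (toℕ-fromℕ< q<len)

    pairClass-surjective : ∀ {j} → j < length xs / 2 → ∃ λ x → x List.∈ xs × pairClass x ≡ j
    pairClass-surjective {j} j<half = at j<len , ∈-lookup _
                                    , trans (cong (_% (length xs / 2)) (position-at j<len)) (m<n⇒m%n≡m j<half)
      where
      j<len : j < length xs
      j<len = <-≤-trans j<half (≤-trans (m≤m+n _ _) (half+half≤ (length xs)))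

    pairClass-partner : ∀ {x} → x List.∈ xs → ∃ λ y → y List.∈ xs × y ≢ x × pairClass y ≡ pairClass x
    pairClass-partner {x} x∈ with %-partner (half+half≤ (length xs)) (position-< x∈)
    ... | q , q<len , q≢p , q%≡p% =
      at q<len , ∈-lookup _
      , (λ y≡x → q≢p (trans (sym (position-at q<len)) (cong (λ z → position z xs) y≡x)))
      , trans (cong (_% (length xs / 2)) (position-at q<len)) q%≡p%

splitAt-injective : ∀ m {n} {i j : Fin (m + n)} → splitAt m i ≡ splitAt m j → i ≡ j
splitAt-injective m {n} {i} {j} eq =
  trans (sym (join-splitAt m n i)) (trans (cong (join m n) eq) (join-splitAt m n j))

module _ {A : Set} (w : A → ℕ) where

  decode : (xs : List A) → Fin (sum (map w xs)) → A × ℕ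
  decode (x ∷ xs) = [ (x ,_) ∘ toℕ , decode xs ] ∘ splitAt (w x)

  decode-valid : ∀ xs i → proj₁ (decode xs i) List.∈ xs × proj₂ (decode xs i) < w (proj₁ (decode xs i))
  decode-valid (x ∷ xs) i with splitAt (w x) i
  ... | inj₁ j = here refl , toℕ<n j
  ... | inj₂ k with decode-valid xs k
  ...   | ∈xs , valid = there ∈xs , valid

  decode-injective : ∀ {xs} → Unique xs → ∀ i i′ → decode xs i ≡ decode xs i′ → i ≡ i′
  decode-injective {x ∷ xs} (x∉xs ∷ xs!) i i′ eq =
    splitAt-injective (w x) (split-injective (splitAt (w x) i) (splitAt (w x) i′) eq)
    where
    split-injective : ∀ s s′ → [ (x ,_) ∘ toℕ , decode xs ] s ≡ [ (x ,_) ∘ toℕ , decode xs ] s′ → s ≡ s′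
    split-injective (inj₁ j) (inj₁ j′) eq = cong inj₁ (toℕ-injective (cong proj₂ eq))
    split-injective (inj₁ j) (inj₂ k′) eq = ⊥-elim (All.lookup x∉xs (proj₁ (decode-valid xs k′)) (cong proj₁ eq))
    split-injective (inj₂ k) (inj₁ j′) eq = ⊥-elim (All.lookup x∉xs (proj₁ (decode-valid xs k)) (cong proj₁ (sym eq)))
    split-injective (inj₂ k) (inj₂ k′) eq = cong inj₂ (decode-injective xs! k k′ eq)

  decode-surjective : ∀ {xs x j} → x List.∈ xs → j < w x → ∃ λ i → decode xs i ≡ (x , j)
  decode-surjective {x ∷ xs} {j = j} (here refl) j<wx =
    fromℕ< j<wx ↑ˡ _ , trans (cong [ (x ,_) ∘ toℕ , decode xs ] (splitAt-↑ˡ (w x) (fromℕ< j<wx) _))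
                             (cong (x ,_) (toℕ-fromℕ< j<wx))
  decode-surjective {y ∷ xs} (there x∈xs) j<wx with decode-surjective x∈xs j<wx
  ... | i , eq = w y ↑ʳ i , trans (cong [ (y ,_) ∘ toℕ , decode xs ] (splitAt-↑ʳ (w y) _ i)) eq

module _ {n k : ℕ} {L : Set} (_≟_ : DecidableEquality L)
         {S : Fin n → Set} (S? : Decidable₁ S) (label : Fin n → L) (code : Fin k → L) where

  fibre : Fin k → Subset n
  fibre i = tabulate λ a → does (S? a ×-dec label a ≟ code i)

  ∈-fibre⁺ : ∀ {i a} → S a → label a ≡ code i → a ∈ fibre i
  ∈-fibre⁺ {i} {a} sa eq = lookup⇒[]= a (fibre i) (trans (lookup∘tabulate _ a) (dec-true (S? a ×-dec label a ≟ code i) (sa , eq)))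

  ∈-fibre⁻ : ∀ {i a} → a ∈ fibre i → S a × label a ≡ code i
  ∈-fibre⁻ {i} {a} a∈ = invert (subst (Reflects _) (trans (sym (lookup∘tabulate _ a)) ([]=⇒lookup a∈))
                                        (proof (S? a ×-dec label a ≟ code i)))

  fibres-partition : ∀ {E : Digraph n} → (∀ i i′ → code i ≡ code i′ → i ≡ i′) →
                     (∀ a → S a → ∃ λ i → code i ≡ label a) →
                     (∀ i → ∃ λ a → S a × label a ≡ code i) →
                     IsPartition E S k fibre
  fibres-partition code-injective labelled inhabited = record
    { nonempty = λ i → let a , sa , eq = inhabited i in a , ∈-fibre⁺ sa eq
    ; disjoint = λ i j a a∈i a∈j → code-injective i j (trans (sym (proj₂ (∈-fibre⁻ a∈i))) (proj₂ (∈-fibre⁻ a∈j)))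
    ; covers   = λ a → mk⇔ (λ sa → let i , eq = labelled a sa in i , ∈-fibre⁺ sa (sym eq))
                           (λ (i , a∈) → proj₁ (∈-fibre⁻ a∈))
    }

module SingleElimination {n : ℕ} {E : Digraph n} (T : IsSET E) where
  open IsSET T

  infixr 5 _++ʷ_
  _++ʷ_ : ∀ {a b c} → Walk E a b → Walk E b c → Walk E a c
  here ++ʷ q = q
  step e p ++ʷ q = step e (p ++ʷ q)

  arc? : Decidable (Arc E)
  arc? a b = E a b Bool.≟ true

  source? : Decidable₁ (Source E)
  source? v = all? λ w → ¬? (arc? w v)

  arc-unique : ∀ {v w w′} → Arc E v w → Arc E v w′ → w ≡ w′
  arc-unique {v} {w} {w′} e e′ with outDegOne v (λ sink → sink w e)
  ... | _ ∷ [] , _ , _ , children = trans (singleton⁻ (Equivalence.from (children w) e))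
                                          (sym (singleton⁻ (Equivalence.from (children w′) e′)))

  only-inNeighbour-impossible : ∀ {v y} → Arc E v y → ¬ (∀ w → Arc E w y → w ≡ v)
  only-inNeighbour-impossible {v} {y} e only =
    inDegNotOne y (v ∷ [] , All.[] ∷ [] , refl , λ w → mk⇔ (λ { (here refl) → e }) (λ e′ → here (only w e′)))

  other-inNeighbour : ∀ {v y} → Arc E v y → ∃ λ w → Arc E w y × w ≢ v
  other-inNeighbour {v} {y} e with any? (λ w → arc? w y ×-dec ¬? (w Fin.≟ v))
  ... | yes other = other
  ... | no none = ⊥-elim (only-inNeighbour-impossible e λ w e′ →
                    decidable-stable (w Fin.≟ v) λ w≢v → none (w , e′ , w≢v))

  inNeighbour : ∀ {v} → Match E v → ∃ λ w → Arc E w v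
  inNeighbour {v} match with any? (λ w → arc? w v)
  ... | yes r = r
  ... | no none = ⊥-elim (match λ w e → none (w , e))

  -- Opaque definitions are used only through the lemmas proved next to them: unfolding them
  -- (above all walk?, a well-founded recursion) makes type checking of later goals explode.
  opaque
    parent : Fin n → Fin n
    parent v with any? (arc? v)
    ... | yes (w , _) = w
    ... | no _ = v

    arc-parent : ∀ {v} → ¬ Sink E v → Arc E v (parent v)
    arc-parent {v} ¬sink with any? (arc? v)
    ... | yes (_ , e) = e
    ... | no none = ⊥-elim (¬sink λ w e → none (w , e))

  parent-unique : ∀ {v w} → Arc E v w → parent v ≡ w
  parent-unique {w = w} e = arc-unique (arc-parent λ sink → sink w e) e

  _⊏_ : Rel (Fin n) _
  a ⊏ b = ∃ λ w → Arc E a w × Walk E w b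

  ⊏-isStrictPartialOrder : IsStrictPartialOrder _≡_ _⊏_
  ⊏-isStrictPartialOrder = record
    { isEquivalence = isEquivalence
    ; irrefl        = λ { refl (w , e , p) → acyclic _ w e p }
    ; trans         = λ (w , e , p) (_ , e′ , q) → w , e , p ++ʷ step e′ q
    ; <-resp-≈      = (λ { refl r → r }) , (λ { refl r → r })
    }

  arc-wellFounded : WellFounded (Arc E)
  arc-wellFounded = Subrelation.wellFounded (λ e → _ , e , here) (spo-wellFounded ⊏-isStrictPartialOrder)

  arc-noetherian : WellFounded (flip (Arc E))
  arc-noetherian = Subrelation.wellFounded (λ e → _ , e , here) (spo-noetherian ⊏-isStrictPartialOrder)

  opaque
    walk? : Decidable (Walk E)
    walk? a v = go a (arc-noetherian a)
      where
      go : ∀ a → Acc (flip (Arc E)) a → Dec (Walk E a v)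
      go a (acc rec) with a Fin.≟ v | any? (arc? a)
      ... | yes refl | _ = yes here
      ... | no a≢v | no none = no λ { here → a≢v refl ; (step e _) → none (_ , e) }
      ... | no a≢v | yes (w , e) with go w (rec e)
      ...   | yes p = yes (step e p)
      ...   | no ¬p = no λ { here → a≢v refl ; (step e′ p) → ¬p (subst (λ x → Walk E x v) (arc-unique e′ e) p) }

  walk-into-source : ∀ {a v} → Source E v → Walk E a v → a ≡ v
  walk-into-source _ here = refl
  walk-into-source src (step e p) with walk-into-source src p
  ... | refl = ⊥-elim (src _ e)

  walk-tail : ∀ {a w v} → Walk E a v → a ≢ v → Arc E a w → Walk E w v
  walk-tail here a≢v _ = ⊥-elim (a≢v refl)
  walk-tail (step e′ p) _ e with arc-unique e e′
  ... | refl = p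

  walks-comparable : ∀ {a x y} → Walk E a x → Walk E a y → Walk E x y ⊎ Walk E y x
  walks-comparable here q = inj₁ q
  walks-comparable p here = inj₂ p
  walks-comparable (step e p) (step e′ q) with arc-unique e e′
  ... | refl = walks-comparable p q

  last-arc : ∀ {a w v} → Arc E a w → Walk E w v → ∃ λ x → Walk E a x × Arc E x v
  last-arc e here = _ , here , e
  last-arc e (step e′ p) with last-arc e′ p
  ... | x , q , e″ = x , step e q , e″

  player-below : ∀ v → ∃ (InP E v)
  player-below v = go v (arc-wellFounded v)
    where
    go : ∀ v → Acc (Arc E) v → ∃ (InP E v)
    go v (acc rec) with source? v
    ... | yes src = v , src , here
    ... | no match with inNeighbour match
    ...   | w , e with go w (rec e)
    ...     | a , pa , p = a , pa , p ++ʷ step e here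

  -- If y → v is the last arc of the walk, take a player below another in-neighbour of v.
  player-avoiding : ∀ {x v} → Walk E x v → x ≢ v → ∃ λ b → InP E v b × ¬ Walk E b x
  player-avoiding here x≢v = ⊥-elim (x≢v refl)
  player-avoiding (step e p) _ with last-arc e p
  ... | y , xy , yv with other-inNeighbour yv
  ...   | y′ , y′v , y′≢y with player-below y′
  ...     | b , pb , by′ = b , (pb , by′ ++ʷ step y′v here) , λ bx →
    [ (λ y′y → acyclic _ _ yv (walk-tail y′y y′≢y y′v))
    , (λ yy′ → acyclic _ _ y′v (walk-tail yy′ (y′≢y ∘ sym) yv)) ] (walks-comparable by′ (bx ++ʷ xy))

  subtree⇒walk : ∀ {u v} → InVSub E u v → Walk E v u
  subtree⇒walk {u} {v} sub with player-below v
  ... | b , pb , bv with walks-comparable bv (proj₂ (sub b (pb , bv)))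
  ...   | inj₁ vu = vu
  ...   | inj₂ uv with u Fin.≟ v
  ...     | yes refl = here
  ...     | no u≢v with player-avoiding uv u≢v
  ...       | b′ , b′∈v , ¬b′u = ⊥-elim (¬b′u (proj₂ (sub b′ b′∈v)))

  walk⇒subtree : ∀ {u v} → Walk E v u → InVSub E u v
  walk⇒subtree vu _ (pa , av) = pa , av ++ʷ vu

  subtree? : ∀ u v → Dec (InVSub E u v)
  subtree? u v = map′ walk⇒subtree subtree⇒walk (walk? v u)

  reaches-sink : ∀ v → ∃ λ s → Sink E s × Walk E v s
  reaches-sink v = go v (arc-noetherian v)
    where
    go : ∀ v → Acc (flip (Arc E)) v → ∃ λ s → Sink E s × Walk E v s
    go v (acc rec) with any? (arc? v)
    ... | no none = v , (λ w e → none (w , e)) , here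
    ... | yes (w , e) with go w (rec e)
    ...   | s , sink , p = s , sink , step e p

  source-sink⇒only-vertex : ∀ {a} → Source E a → Sink E a → ∀ v → v ≡ a
  source-sink⇒only-vertex {a} src sink v with reaches-sink v
  ... | s , sink-s , vs = walk-into-source src (subst (Walk E v) (trans (the-sink s sink-s) (sym (the-sink a sink))) vs)
    where
    the-sink : ∀ v → Sink E v → v ≡ proj₁ oneSink
    the-sink = proj₂ (proj₂ oneSink)

module Construction {n : ℕ} {E : Digraph n} (T : IsSET E) (u : Fin n)
  (no-pair : ¬ (Σ (Fin n) λ x → Σ (Fin n) λ a →
               Arc E u x × Player E a × (∀ y → Arc E y x ⇔ (y ≡ a ⊎ y ≡ u)))) where
  open SingleElimination T

  Outside : Fin n → Set
  Outside = OutsideP E u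

  Exterior : Fin n → Set
  Exterior x = Match E x × ¬ InVSub E u x

  outside? : Decidable₁ Outside
  outside? a = source? a ×-dec ¬? (source? a ×-dec walk? a u)

  exterior? : Decidable₁ Exterior
  exterior? x = ¬? (source? x) ×-dec ¬? (subtree? u x)

  OutsideChild : Fin n → Fin n → Set
  OutsideChild x a = Arc E a x × Outside a

  outsideChild? : ∀ x → Decidable₁ (OutsideChild x)
  outsideChild? x a = arc? a x ×-dec outside? a

  opaque
    outsideChildren : Fin n → List (Fin n)
    outsideChildren x = filter (outsideChild? x) (allFin n)

    outsideChildren-unique : ∀ x → Unique (outsideChildren x)
    outsideChildren-unique x = filter⁺ (outsideChild? x) (allFin⁺ n)

    ∈-outsideChildren⁺ : ∀ {x a} → OutsideChild x a → a List.∈ outsideChildren x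
    ∈-outsideChildren⁺ {x} = ∈-filter⁺ (outsideChild? x) (∈-allFin _)

    ∈-outsideChildren⁻ : ∀ {x a} → a List.∈ outsideChildren x → OutsideChild x a
    ∈-outsideChildren⁻ {x} a∈ = proj₂ (∈-filter⁻ (outsideChild? x) {xs = allFin n} a∈)

  count : Fin n → ℕ
  count x = length (outsideChildren x)

  count-Card : ∀ x → Card E (OutsideChild x) (count x)
  count-Card x = outsideChildren x , outsideChildren-unique x , refl
               , λ a → mk⇔ ∈-outsideChildren⁻ ∈-outsideChildren⁺

  -- This is why the theorem does not need 2 ≤ n.
  outside-not-sink : ∀ {a} → Outside a → ¬ Sink E a
  outside-not-sink (src , a∉u) sink = a∉u (src , subst (Walk E _) (sym (source-sink⇒only-vertex src sink u)) here)

  arc-to-parent : ∀ {a} → Outside a → Arc E a (parent a)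
  arc-to-parent out = arc-parent (outside-not-sink out)

  parent-exterior : ∀ {a} → Outside a → Exterior (parent a)
  parent-exterior {a} out@(src , a∉u) =
    (λ src′ → src′ a (arc-to-parent out)) , λ sub → a∉u (sub a (src , step (arc-to-parent out) here))

  inNeighbour-of-exterior-↛u : ∀ {w y} → Exterior y → Arc E w y → w ≢ u → ¬ Walk E w u
  inNeighbour-of-exterior-↛u (_ , y∉u) wy w≢u wu = y∉u (walk⇒subtree (walk-tail wu w≢u wy))

  inNeighbour-of-exterior : ∀ {w y} → Exterior y → Arc E w y → w ≢ u → Outside w ⊎ Exterior w
  inNeighbour-of-exterior {w} ext wy w≢u with source? w
  ... | yes src = inj₁ (src , inNeighbour-of-exterior-↛u ext wy w≢u ∘ proj₂)
  ... | no match = inj₂ (match , inNeighbour-of-exterior-↛u ext wy w≢u ∘ subtree⇒walk)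

  -- If no in-neighbour of y were exterior, all in-neighbours other than u would be outside players,
  -- hence N⁻(y) would be {a , u} or {a}: the first is excluded by the hypothesis, the second by IsSET.
  exterior-child : ∀ {y} → Exterior y → count y ≤ 1 → ∃ λ y′ → Arc E y′ y × Exterior y′
  exterior-child {y} ext count≤1 with any? (λ y′ → arc? y′ y ×-dec exterior? y′)
  ... | yes found = found
  ... | no none = ⊥-elim contradiction
    where
    outside-child : ∀ {w} → Arc E w y → w ≢ u → w List.∈ outsideChildren y
    outside-child wy w≢u with inNeighbour-of-exterior ext wy w≢u
    ... | inj₁ out = ∈-outsideChildren⁺ (wy , out)
    ... | inj₂ ext′ = ⊥-elim (none (_ , wy , ext′))

    same : ∀ {w w′} → Arc E w y → w ≢ u → Arc E w′ y → w′ ≢ u → w ≡ w′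
    same wy w≢u w′y w′≢u = ∈-length≤1 count≤1 (outside-child wy w≢u) (outside-child w′y w′≢u)

    in-pair : ∀ {a} → Arc E a y → a ≢ u → ∀ w → Arc E w y → w ≡ a ⊎ w ≡ u
    in-pair ay a≢u w wy with w Fin.≟ u
    ... | yes w≡u = inj₂ w≡u
    ... | no w≢u = inj₁ (same wy w≢u ay a≢u)

    contradiction : ⊥
    contradiction with arc? u y
    ... | yes uy with other-inNeighbour uy
    ...   | a , ay , a≢u = no-pair (y , a , uy , proj₁ (proj₂ (∈-outsideChildren⁻ (outside-child ay a≢u)))
                                   , λ w → mk⇔ (in-pair ay a≢u w) [ (λ { refl → ay }) , (λ { refl → uy }) ])
    contradiction | no ¬uy with inNeighbour (proj₁ ext)
    ... | v , vy = only-inNeighbour-impossible vy λ w wy → same wy (≢u wy) vy (≢u vy)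
      where
      ≢u : ∀ {w} → Arc E w y → w ≢ u
      ≢u wy refl = ¬uy wy

  Rich : Fin n → Set
  Rich z = Exterior z × 2 ≤ count z

  rich? : Decidable₁ Rich
  rich? z = exterior? z ×-dec 2 ≤? count z

  rich-below : ∀ {y} → Exterior y → ∃ λ z → Walk E z y × Rich z
  rich-below {y} = go y (arc-wellFounded y)
    where
    go : ∀ y → Acc (Arc E) y → Exterior y → ∃ λ z → Walk E z y × Rich z
    go y (acc rec) ext with 2 ≤? count y
    ... | yes 2≤count = y , here , ext , 2≤count
    ... | no 2≰count with exterior-child ext (s≤s⁻¹ (≰⇒> 2≰count))
    ...   | y′ , y′y , ext′ with go y′ (rec y′y) ext′
    ...     | z , zy′ , rich = z , zy′ ++ʷ step y′y here , rich

  opaque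
    anchor : Fin n → Fin n
    anchor w with any? (λ z → walk? z w ×-dec rich? z)
    ... | yes (z , _) = z
    ... | no _ = w

    anchor-below : ∀ {w} → Exterior w → Walk E (anchor w) w × Rich (anchor w)
    anchor-below {w} ext with any? (λ z → walk? z w ×-dec rich? z)
    ... | yes (_ , found) = found
    ... | no none = ⊥-elim (none (rich-below ext))

  module Pairing (w : Fin n) (rich : 2 ≤ count w) = PairUp Fin._≟_ (outsideChildren-unique w) rich

  class : ∀ w → 2 ≤ count w → Fin n → ℕ
  class = Pairing.pairClass

  opaque
    labelAt : Fin n → Fin n → Fin n × ℕ
    labelAt w a with 2 ≤? count w
    ... | yes rich = w , class w rich a
    ... | no _ = anchor w , 0

    labelAt-rich : ∀ {w a} (rich : 2 ≤ count w) → labelAt w a ≡ (w , class w rich a)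
    labelAt-rich {w} rich with 2 ≤? count w
    ... | yes _ = refl
    ... | no 2≰count = ⊥-elim (2≰count rich)

    labelAt-poor : ∀ {w a} → ¬ 2 ≤ count w → labelAt w a ≡ (anchor w , 0)
    labelAt-poor {w} 2≰count with 2 ≤? count w
    ... | yes rich = ⊥-elim (2≰count rich)
    ... | no _ = refl

  label : Fin n → Fin n × ℕ
  label a = labelAt (parent a) a

  label-child : ∀ {w a} → Arc E a w → (rich : 2 ≤ count w) → label a ≡ (w , class w rich a)
  label-child {a = a} aw rich = trans (cong (λ w → labelAt w a) (parent-unique aw)) (labelAt-rich rich)

  opaque
    weight : Fin n → ℕ
    weight x with exterior? x
    ... | yes _ = count x / 2
    ... | no _ = 0

    weight-exterior : ∀ {x} → Exterior x → weight x ≡ count x / 2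
    weight-exterior {x} ext with exterior? x
    ... | yes _ = refl
    ... | no ¬ext = ⊥-elim (¬ext ext)

    weight-interior : ∀ {x} → ¬ Exterior x → weight x ≡ 0
    weight-interior {x} ¬ext with exterior? x
    ... | yes ext = ⊥-elim (¬ext ext)
    ... | no _ = refl

    <weight⇒rich : ∀ {x j} → j < weight x → Σ (Rich x) λ (_ , rich) → j < count x / 2
    <weight⇒rich {x} {j} j<weight with exterior? x
    ... | yes ext = (ext , m/n≢0⇒n≤m λ half≡0 → n≮0 (subst (j <_) half≡0 j<weight)) , j<weight
    ... | no _ = ⊥-elim (n≮0 j<weight)

  label-valid : ∀ {a} → Outside a → proj₂ (label a) < weight (proj₁ (label a))
  label-valid {a} out with 2 ≤? count (parent a)
  ... | yes rich = subst (λ (x , j) → j < weight x) (sym (labelAt-rich rich))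
                     (subst (class (parent a) rich a <_) (sym (weight-exterior (parent-exterior out)))
                       (Pairing.pairClass-< _ rich a))
  ... | no poor with anchor-below (parent-exterior out)
  ...   | _ , ext , rich = subst (λ (x , j) → j < weight x) (sym (labelAt-poor poor))
                             (subst (0 <_) (sym (weight-exterior ext)) (m≥n⇒m/n>0 rich))

  label-inhabited : ∀ {x j} → j < weight x → ∃ λ a → Outside a × label a ≡ (x , j)
  label-inhabited j<weight with <weight⇒rich j<weight
  ... | (_ , rich) , j<half with Pairing.pairClass-surjective _ rich j<half
  ...   | a , a∈ , class≡j with ∈-outsideChildren⁻ a∈
  ...     | ax , out = a , out , trans (label-child ax rich) (cong (_ ,_) class≡j)

  Partner : Fin n → Set
  Partner a = ∃ λ b → Outside b × label b ≡ label a × b ≢ a × Walk E b (parent a)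

  partner-rich : ∀ {a} → Outside a → 2 ≤ count (parent a) → Partner a
  partner-rich {a} out rich
    with Pairing.pairClass-partner _ rich (∈-outsideChildren⁺ (arc-to-parent out , out))
  ... | b , b∈ , b≢a , class≡ with ∈-outsideChildren⁻ b∈
  ...   | bw , outb = b , outb
                    , trans (label-child bw rich) (trans (cong (_ ,_) class≡) (sym (labelAt-rich rich)))
                    , b≢a , step bw here

  partner-poor : ∀ {a} → Outside a → ¬ 2 ≤ count (parent a) → Partner a
  partner-poor {a} out poor with anchor-below (parent-exterior out)
  ... | zw , _ , rich with Pairing.pairClass-surjective _ rich (m≥n⇒m/n>0 rich)
  ...   | b , b∈ , class≡0 with ∈-outsideChildren⁻ b∈
  ...     | bz , outb = b , outb
                      , trans (label-child bz rich) (trans (cong (_ ,_) class≡0) (sym (labelAt-poor poor)))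
                      , (λ { refl → poor (subst (λ w → 2 ≤ count w) (sym (parent-unique bz)) rich) })
                      , step bz zw

  partner : ∀ {a} → Outside a → Partner a
  partner {a} out with 2 ≤? count (parent a)
  ... | yes rich = partner-rich out rich
  ... | no poor = partner-poor out poor

  blockCount : ℕ
  blockCount = sum (map weight (allFin n))

  blockLabel : Fin blockCount → Fin n × ℕ
  blockLabel = decode weight (allFin n)

  _≟ˡ_ : DecidableEquality (Fin n × ℕ)
  _≟ˡ_ = ≡-dec Fin._≟_ ℕ._≟_

  block : Fin blockCount → Subset n
  block = fibre _≟ˡ_ outside? label blockLabel

  block-partition : IsPartition E Outside blockCount block
  block-partition = fibres-partition _≟ˡ_ outside? label blockLabel
    (decode-injective weight (allFin⁺ n))
    (λ a out → decode-surjective weight (∈-allFin _) (label-valid out))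
    (λ i → label-inhabited (proj₂ (decode-valid weight (allFin n) i)))

  block-partner : ∀ i a → a ∈ block i →
                  ∃ λ b → b ∈ block i × b ≢ a × (∀ x → Match E x → InP E x a → InP E x b)
  block-partner i a a∈ with ∈-fibre⁻ _≟ˡ_ outside? label blockLabel a∈
  ... | out , label≡ with partner out
  ...   | b , outb , same-label , b≢a , b↝parent =
    b , ∈-fibre⁺ _≟ˡ_ outside? label blockLabel outb (trans same-label label≡) , b≢a ,
    λ x match (_ , ax) → proj₁ outb , b↝parent ++ʷ walk-tail ax (λ { refl → match (proj₁ out) }) (arc-to-parent out)

  SumRel-weights : ∀ xs → SumRel E Exterior (λ x c → Card E (OutsideChild x) c) xs (sum (map weight xs))
  SumRel-weights [] = []
  SumRel-weights (x ∷ xs) with exterior? x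
  ... | yes ext = subst (λ c → SumRel E _ _ _ (c + _)) (sym (weight-exterior ext))
                    (take ext (count-Card x) (SumRel-weights xs))
  ... | no ¬ext = subst (λ c → SumRel E _ _ _ (c + _)) (sym (weight-interior ¬ext)) (skip ¬ext (SumRel-weights xs))

lemma5p12 : (n : ℕ) → 2 ≤ n → (E : Digraph n) → IsSET E → (u : Fin n) →
    ¬ (Σ (Fin n) λ x → Σ (Fin n) λ a →
         Arc E u x × Player E a × (∀ y → Arc E y x ⇔ (y ≡ a ⊎ y ≡ u))) →
    Σ ℕ λ k → Σ (Fin k → Subset n) λ B →
      IsPartition E (OutsideP E u) k B
      × (∀ i a → a ∈ B i →
           Σ (Fin n) λ b → b ∈ B i × b ≢ a
             × (∀ x → Match E x → InP E x a → InP E x b))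
      × SumRel E (λ x → Match E x × ¬ InVSub E u x)
                 (λ x c → Card E (λ y → Arc E y x × OutsideP E u y) c)
                 (allFin n) k
lemma5p12 n _ E T u no-pair = blockCount , block , block-partition , block-partner , SumRel-weights (allFin n)
  where open Construction T u no-pair
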